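{- Let $n\ge 4$ and let $d$ be a positive integer. Let $G$ be a graph having no induced subgraph isomorphic to $P_n$, and let $P$ be a path of length $1$ in $G$. If $\Omega(G,P)$ has a component $C$ attached to $P$ with $\chi(C)>d(n-3)$, then $G$ has a $d$-good induced path $P'$ extending $P$.
   Context: $P_n$ is the path graph on $n$ vertices. A path from $v$ to $w$ is a sequence $v_0v_1\cdots v_\ell$ of distinct vertices with $v_0=v$, $v_\ell=w$ and $v_i$ adjacent to $v_{i-1}$ for all $i$; its length is $\ell$ and $w$ is its last vertex. A path $w_0\cdots w_m$ extends $v_0\cdots v_\ell$ if $m\ge\ell$ and $w_i=v_i$ for $i\le\ell$. For a set $X$ of vertices, $N_G(X)=(\bigcup_{x\in X}N_G(x))\setminus X$. For an induced path $P$ from $v$ to $w$ in $G$, $\Omega(G,P)$ denotes $G\setminus(V(P)\cup N_G(V(P)\setminus\{w\}))$. A component of $\Omega(G,P)$ is attached to $P$ if it contains a neighbor of $w$. A component $C$ of $\Omega(G,P)$ is $d$-good if the neighbors of $w$ in $C$ induce a graph of chromatic number larger than $d$. The path $P$ is $d$-good in $G$ if $\Omega(G,P)$ has a $d$-good component. -}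

module Defs where

open import Data.Nat using (ℕ; zero; suc; _≤_)
open import Data.Fin using (Fin; toℕ; fromℕ)
open import Data.Bool using (Bool; T)
open import Data.Product using (Σ; ∃; _×_; _,_)
open import Data.Sum using (_⊎_)
open import Data.Empty using (⊥)
open import Relation.Nullary using (¬_)
open import Relation.Binary.PropositionalEquality using (_≡_; _≢_)
open import Function.Definitions using (Injective)
open import Function.Bundles using (_⇔_)

record Graph : Set where
  field
    N      : ℕ
    adj    : Fin N → Fin N → Bool
    sym    : ∀ u v → adj u v ≡ adj v u
    irrefl : ∀ v → adj v v ≡ Data.Bool.false

open Graph public

Vertex : Graph → Set
Vertex G = Fin (N G)

Adj : (G : Graph) → Vertex G → Vertex G → Set
Adj G u v = T (adj G u v)

VSet : Graph → Set₁
VSet G = Vertex G → Set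

PathAdj : {k : ℕ} → Fin k → Fin k → Set
PathAdj i j = (toℕ j ≡ suc (toℕ i)) ⊎ (toℕ i ≡ suc (toℕ j))

HasInducedP : Graph → ℕ → Set
HasInducedP G k = Σ (Fin k → Vertex G) λ f →
  Injective _≡_ _≡_ f × (∀ i j → Adj G (f i) (f j) ⇔ PathAdj i j)

record Seq (G : Graph) : Set where
  constructor seq
  field
    len : ℕ
    vtx : Fin (suc len) → Vertex G

open Seq public

lastV : {G : Graph} → Seq G → Vertex G
lastV P = vtx P (fromℕ (len P))

IsPath : (G : Graph) → Seq G → Set
IsPath G P = Injective _≡_ _≡_ (vtx P) ×
  (∀ i j → PathAdj i j → Adj G (vtx P i) (vtx P j))

IsInducedPath : (G : Graph) → Seq G → Set
IsInducedPath G P = Injective _≡_ _≡_ (vtx P) ×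
  (∀ i j → Adj G (vtx P i) (vtx P j) ⇔ PathAdj i j)

Extends : {G : Graph} → Seq G → Seq G → Set
Extends Q P = (len P ≤ len Q) ×
  (∀ (i : Fin (suc (len P))) (j : Fin (suc (len Q))) → toℕ i ≡ toℕ j → vtx Q j ≡ vtx P i)

-- vertex set of Ω(G,P) = G \ (V(P) ∪ N_G(V(P) \ {w}))
InΩ : (G : Graph) → Seq G → VSet G
InΩ G P v = (∀ i → vtx P i ≢ v) ×
  (∀ i → vtx P i ≢ lastV P → ¬ Adj G (vtx P i) v)

data Reach (G : Graph) (X : VSet G) (r : Vertex G) : Vertex G → Set where
  here : X r → Reach G X r r
  step : ∀ {u v} → Reach G X r u → X v → Adj G u v → Reach G X r v

Component : (G : Graph) → VSet G → Vertex G → VSet G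
Component G X r = Reach G X r

Colourable : (G : Graph) → VSet G → ℕ → Set
Colourable G X k = Σ (Vertex G → Fin k) λ c →
  ∀ u v → X u → X v → Adj G u v → c u ≢ c v

ChiGt : (G : Graph) → VSet G → ℕ → Set
ChiGt G X k = ¬ Colourable G X k

Attached : (G : Graph) → (P : Seq G) → Vertex G → Set
Attached G P r = ∃ λ u → Component G (InΩ G P) r u × Adj G (lastV P) u

DGoodComp : (G : Graph) → (P : Seq G) → ℕ → Vertex G → Set
DGoodComp G P d r = ChiGt G (λ u → Component G (InΩ G P) r u × Adj G (lastV P) u) d

DGood : (G : Graph) → Seq G → ℕ → Set
DGood G P d = ∃ λ r → InΩ G P r × DGoodComp G P d r

module Submission where

-- The proof is an induction on the number k of extensions still possible
-- before an induced P_n would appear.  Let A = C ∩ N(w) and B = C ∖ N(w).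
-- If χ(A) > d, P itself is d-good.  Otherwise, if some component D of B has
-- χ(D) > d(k-1), a walk inside C from D to A enters A at a vertex u, and D
-- lies in an attached component of Ω(G, P u), so induction applies to the
-- induced path P u.  If neither happens, colouring A with d colours and all
-- components of B with d(k-1) fresh colours gives χ(C) ≤ dk, a contradiction.
-- When k = 0, appending any neighbour of w in C yields an induced P_n.

open import Defs hiding (sym)
open import Level using (0ℓ)
open import Data.Nat using (ℕ; zero; suc; _+_; _*_; _∸_; _≤_; _<_; s≤s)
open import Data.Nat.Properties using (≤-refl; ≤-trans; n≤1+n; +-identityʳ; +-suc; *-suc; n<1+n; <-asym; 1+n≢n; suc-injective)
open import Data.Fin using (Fin; zero; suc; toℕ; fromℕ; inject₁; fromℕ<; join; splitAt)
open import Data.Fin.Properties using (toℕ-injective; toℕ-inject₁; toℕ-fromℕ; toℕ-fromℕ<; toℕ<n; any?; all?; splitAt-join; _≟_)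
open import Data.Fin.Relation.Unary.Top using (view; ‵fromℕ; ‵inject₁)
open import Data.Fin.Subset using (_∈_; _-_; ⊤; _⊂_)
open import Data.Fin.Subset.Properties using (∈⊤; x∈p⇒p-x⊂p; x∈p∧x∉q⇒x∈p─q; x≢y⇒x∉⁅y⁆)
open import Data.Fin.Subset.Induction using (⊂-wellFounded; Acc; acc)
open import Data.Vec.Functional using (_∷_)
open import Data.Bool using (T)
open import Data.Product using (Σ; ∃; ∃₂; _×_; _,_; proj₁; proj₂)
open import Data.Sum using (_⊎_; inj₁; inj₂; swap; [_,_]′)
open import Data.Sum.Properties using (inj₁-injective; inj₂-injective)
open import Data.Empty using (⊥-elim)
open import Function using (_∘_; id)
open import Function.Bundles using (_⇔_; mk⇔)
open import Function.Properties.Equivalence using () renaming (refl to ⇔-refl; sym to ⇔-sym; trans to ⇔-trans)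
open import Relation.Nullary using (¬_; Dec; yes; no; ¬?)
open import Relation.Nullary.Decidable using (_×-dec_; _→-dec_; map′; decidable-stable; T?)
open import Relation.Unary using (Pred; Decidable; _⊆_; _∩_; _∖_)
open import Relation.Unary.Properties using (_∩?_; ∁?)
open import Relation.Binary.PropositionalEquality using (_≡_; _≢_; refl; sym; trans; cong; subst; _≗_; module ≡-Reasoning)

-- Well-founded induction on predicates over Fin n: Q X may be assumed for
-- every X' ⊆ X that misses some member r of X.  (Measure: a finite subset
-- containing X, which loses r at each step.)
shrinking-induction : ∀ {n} (Q : Pred (Fin n) 0ℓ → Set) →
  (∀ X → (∀ {r} → X r → ∀ X' → X' ⊆ X → ¬ X' r → Q X') → Q X) →
  ∀ X → Q X
shrinking-induction Q shrink X = go ⊤ (⊂-wellFounded ⊤) X (λ _ → ∈⊤)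
  where
  go : ∀ S → Acc _⊂_ S → ∀ X → X ⊆ (_∈ S) → Q X
  go S (acc smaller) X X⊆S = shrink X λ {r} Xr X' X'⊆X ¬X'r →
    go (S - r) (smaller (x∈p⇒p-x⊂p (X⊆S Xr))) X'
       λ X'v → x∈p∧x∉q⇒x∈p─q (X⊆S (X'⊆X X'v)) (x≢y⇒x∉⁅y⁆ λ { refl → ¬X'r X'v })

∃-map? : ∀ m {k} (Q : (Fin m → Fin k) → Set) →
  (∀ {f g} → f ≗ g → Q f → Q g) → (∀ f → Dec (Q f)) → Dec (∃ Q)
∃-map? zero Q resp Q? = map′ (λ q → (λ ()) , q) only-map (Q? (λ ()))
  where
  only-map : ∃ Q → Q (λ ())
  only-map (f , q) = resp (λ ()) q
∃-map? (suc m) {k} Q resp Q? = map′ cons-map split-map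
  (any? λ a → ∃-map? m (Q ∘ (a ∷_)) (λ f≗g → resp (cons-≗ a f≗g)) (Q? ∘ (a ∷_)))
  where
  cons-≗ : ∀ a {f g : Fin m → Fin k} → f ≗ g → (a ∷ f) ≗ (a ∷ g)
  cons-≗ a f≗g zero = refl
  cons-≗ a f≗g (suc i) = f≗g i
  cons-map : (∃ λ a → ∃ λ f → Q (a ∷ f)) → ∃ Q
  cons-map (a , f , q) = (a ∷ f) , q
  split-map : ∃ Q → ∃ λ a → ∃ λ f → Q (a ∷ f)
  split-map (f , q) = f zero , (f ∘ suc) , resp head-tail q
    where
    head-tail : f ≗ (f zero ∷ (f ∘ suc))
    head-tail zero = refl
    head-tail (suc i) = refl

join-injective : ∀ m n {x y : Fin m ⊎ Fin n} → join m n x ≡ join m n y → x ≡ y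
join-injective m n {x} {y} e =
  trans (sym (splitAt-join m n x)) (trans (cong (splitAt m) e) (splitAt-join m n y))

pathAdj-sym : ∀ {k} {i j : Fin k} → PathAdj i j → PathAdj j i
pathAdj-sym = swap

pathAdj-irrefl : ∀ {k} {i : Fin k} → ¬ PathAdj i i
pathAdj-irrefl (inj₁ e) = 1+n≢n (sym e)
pathAdj-irrefl (inj₂ e) = 1+n≢n (sym e)

pathAdj-inject₁ : ∀ {k} (i j : Fin k) → PathAdj (inject₁ i) (inject₁ j) ⇔ PathAdj i j
pathAdj-inject₁ i j rewrite toℕ-inject₁ i | toℕ-inject₁ j = ⇔-refl

pathAdj-last : ∀ {l} (i : Fin (suc l)) → PathAdj (inject₁ i) (fromℕ (suc l)) ⇔ i ≡ fromℕ l
pathAdj-last {l} i = mk⇔ to from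
  where
  to : PathAdj (inject₁ i) (fromℕ (suc l)) → i ≡ fromℕ l
  to (inj₁ e) = toℕ-injective (begin
      toℕ i            ≡⟨ toℕ-inject₁ i ⟨
      toℕ (inject₁ i)  ≡⟨ suc-injective (trans (sym e) (toℕ-fromℕ (suc l))) ⟩
      l                ≡⟨ toℕ-fromℕ l ⟨
      toℕ (fromℕ l)    ∎)
    where open ≡-Reasoning
  to (inj₂ e) = ⊥-elim (<-asym (n<1+n (suc l)) (subst (_< suc l) i≡2+l (toℕ<n i)))
    where
    i≡2+l : toℕ i ≡ suc (suc l)
    i≡2+l = trans (sym (toℕ-inject₁ i)) (trans e (cong suc (toℕ-fromℕ (suc l))))
  from : i ≡ fromℕ l → PathAdj (inject₁ i) (fromℕ (suc l))
  from refl = inj₁ (trans (toℕ-fromℕ (suc l))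
    (cong suc (sym (trans (toℕ-inject₁ (fromℕ l)) (toℕ-fromℕ l)))))

snoc : ∀ {A : Set} {l} → (Fin (suc l) → A) → A → Fin (suc (suc l)) → A
snoc f u zero = f zero
snoc {l = zero} f u (suc _) = u
snoc {l = suc l} f u (suc j) = snoc (f ∘ suc) u j

snoc-inject₁ : ∀ {A : Set} {l} (f : Fin (suc l) → A) u i → snoc f u (inject₁ i) ≡ f i
snoc-inject₁ {l = zero} f u zero = refl
snoc-inject₁ {l = suc l} f u zero = refl
snoc-inject₁ {l = suc l} f u (suc i) = snoc-inject₁ (f ∘ suc) u i

snoc-last : ∀ {A : Set} {l} (f : Fin (suc l) → A) u → snoc f u (fromℕ (suc l)) ≡ u
snoc-last {l = zero} f u = refl
snoc-last {l = suc l} f u = snoc-last (f ∘ suc) u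

_▹_ : {G : Graph} → Seq G → Vertex G → Seq G
P ▹ u = seq (suc (len P)) (snoc (vtx P) u)

last-▹ : {G : Graph} (P : Seq G) (u : Vertex G) → lastV (P ▹ u) ≡ u
last-▹ P u = snoc-last (vtx P) u

extends-refl : {G : Graph} (P : Seq G) → Extends P P
extends-refl P = ≤-refl , λ i j e → cong (vtx P) (sym (toℕ-injective e))

extends-trans : {G : Graph} {R Q P : Seq G} → Extends R Q → Extends Q P → Extends R P
extends-trans (Q≤R , R≈Q) (P≤Q , Q≈P) = ≤-trans P≤Q Q≤R , λ i k i≡k →
  let i<Q = ≤-trans (toℕ<n i) (s≤s P≤Q)
      j = fromℕ< i<Q
  in trans (R≈Q j k (trans (toℕ-fromℕ< i<Q) i≡k)) (Q≈P i j (sym (toℕ-fromℕ< i<Q)))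

extends-▹ : {G : Graph} (P : Seq G) (u : Vertex G) → Extends (P ▹ u) P
extends-▹ P u = n≤1+n (len P) , λ i j i≡j →
  subst (λ z → snoc (vtx P) u z ≡ vtx P i)
        (toℕ-injective (trans (toℕ-inject₁ i) i≡j)) (snoc-inject₁ (vtx P) u i)

module _ (G : Graph) where

  adj-sym : ∀ {u v} → Adj G u v → Adj G v u
  adj-sym {u} {v} = subst T (Graph.sym G u v)

  adj-irrefl : ∀ {v} → ¬ Adj G v v
  adj-irrefl {v} = subst T (irrefl G v)

  adj? : ∀ u v → Dec (Adj G u v)
  adj? u v = T? (adj G u v)

  reach-start : ∀ {X r v} → Reach G X r v → X r
  reach-start (here Xr) = Xr
  reach-start (step R _ _) = reach-start R

  reach-end : ∀ {X r v} → Reach G X r v → X v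
  reach-end (here Xr) = Xr
  reach-end (step _ Xv _) = Xv

  reach-mono : ∀ {X Y : VSet G} → X ⊆ Y → ∀ {r v} → Reach G X r v → Reach G Y r v
  reach-mono X⊆Y (here Xr) = here (X⊆Y Xr)
  reach-mono X⊆Y (step R Xv uv) = step (reach-mono X⊆Y R) (X⊆Y Xv) uv

  reach-prepend : ∀ {X r u v} → X r → Adj G r u → Reach G X u v → Reach G X r v
  reach-prepend Xr ru (here Xu) = step (here Xr) Xu ru
  reach-prepend Xr ru (step R Xv wv) = step (reach-prepend Xr ru R) Xv wv

  reach-sym : ∀ {X r v} → Reach G X r v → Reach G X v r
  reach-sym (here Xr) = here Xr
  reach-sym (step R Xv uv) = reach-prepend Xv (adj-sym uv) (reach-sym R)

  reach-trans : ∀ {X r u v} → Reach G X r u → Reach G X u v → Reach G X r v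
  reach-trans R (here _) = R
  reach-trans R (step R' Xv uv) = step (reach-trans R R') Xv uv

  reach-within : ∀ {X r x v} → Component G X r x → Reach G X x v → Reach G (Component G X r) x v
  reach-within Crx (here _) = here Crx
  reach-within Crx (step R Xv uv) =
    let R' = reach-within Crx R in step R' (step (reach-end R') Xv uv) uv

  reach-split : ∀ {X r v} → Reach G X r v →
    v ≡ r ⊎ ∃ λ u → Adj G r u × Reach G (λ x → X x × x ≢ r) u v
  reach-split (here _) = inj₁ refl
  reach-split {r = r} (step {v = v} R Xv uv) with v ≟ r
  ... | yes v≡r = inj₁ v≡r
  ... | no v≢r with reach-split R
  ...   | inj₁ refl = inj₂ (v , uv , here (Xv , v≢r))
  ...   | inj₂ (u' , ru' , R') = inj₂ (u' , ru' , step R' (Xv , v≢r) uv)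

  -- Reachability inside a decidable vertex set is decidable: either v = r,
  -- or some neighbour of r reaches v in the smaller set X ∖ {r}.
  reach? : ∀ {X : VSet G} → Decidable X → ∀ r v → Dec (Reach G X r v)
  reach? {X} = shrinking-induction (λ X → Decidable X → ∀ r v → Dec (Reach G X r v)) search X
    where
    search : ∀ X → (∀ {r} → X r → ∀ X' → X' ⊆ X → ¬ X' r →
                      Decidable X' → ∀ r' v → Dec (Reach G X' r' v)) →
             Decidable X → ∀ r v → Dec (Reach G X r v)
    search X smaller X? r v with X? r
    ... | no ¬Xr = no (¬Xr ∘ reach-start)
    ... | yes Xr with v ≟ r
    ...   | yes refl = yes (here Xr)
    ...   | no v≢r = map′ via-neighbour (λ R → [ ⊥-elim ∘ v≢r , id ]′ (reach-split R))
              (any? λ u → adj? r u ×-dec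
                 smaller Xr (λ x → X x × x ≢ r) proj₁ (λ (_ , r≢r) → r≢r refl)
                         (λ x → X? x ×-dec ¬? (x ≟ r)) u v)
      where
      via-neighbour : (∃ λ u → Adj G r u × Reach G (λ x → X x × x ≢ r) u v) → Reach G X r v
      via-neighbour (u , ru , R) = reach-prepend Xr ru (reach-mono proj₁ R)

  first-entry : ∀ {X A : VSet G} → Decidable A → ∀ {x v} → Reach G X x v → ¬ A x →
    Reach G (X ∖ A) x v ⊎ ∃₂ λ p u → Reach G (X ∖ A) x p × Adj G p u × (X ∩ A) u
  first-entry A? (here Xx) ¬Ax = inj₁ (here (Xx , ¬Ax))
  first-entry A? (step {u} {v} R Xv uv) ¬Ax with first-entry A? R ¬Ax
  ... | inj₂ entry = inj₂ entry
  ... | inj₁ R' with A? v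
  ...   | yes Av = inj₂ (u , v , R' , uv , Xv , Av)
  ...   | no ¬Av = inj₁ (step R' (Xv , ¬Av) uv)

  -- Besides the total colourings of Defs we use colourings
  -- defined only on X; they make the empty set k-colourable for every k,
  -- which lets colourings be glued without a default colour.
  ColouringOf : VSet G → ℕ → Set
  ColouringOf X k = Σ ((v : Vertex G) → X v → Fin k) λ c →
    ∀ {u v} (Xu : X u) (Xv : X v) → Adj G u v → c u Xu ≢ c v Xv

  restrict : ∀ {X k} → Colourable G X k → ColouringOf X k
  restrict (c , proper) = (λ v _ → c v) , λ Xu Xv → proper _ _ Xu Xv

  totalise : ∀ {X k r} → Decidable X → X r → ColouringOf X k → Colourable G X k
  totalise {X} {k} {r} X? Xr (c , proper) = c' , proper'
    where
    pick : ∀ v → Dec (X v) → Fin k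
    pick v (yes Xv) = c v Xv
    pick v (no _) = c r Xr
    c' : Vertex G → Fin k
    c' v = pick v (X? v)
    proper' : ∀ u v → X u → X v → Adj G u v → c' u ≢ c' v
    proper' u v Xu Xv uv with X? u | X? v
    ... | yes Xu' | yes Xv' = proper Xu' Xv' uv
    ... | no ¬Xu | _ = ⊥-elim (¬Xu Xu)
    ... | yes _ | no ¬Xv = ⊥-elim (¬Xv Xv)

  colouring-mono : ∀ {X Y k} → X ⊆ Y → ColouringOf Y k → ColouringOf X k
  colouring-mono X⊆Y (c , proper) = (λ v Xv → c v (X⊆Y Xv)) , λ Xu Xv → proper (X⊆Y Xu) (X⊆Y Xv)

  χ-mono : ∀ {X Y k} → X ⊆ Y → ChiGt G X k → ChiGt G Y k
  χ-mono X⊆Y χX (c , proper) = χX (c , λ u v Xu Xv → proper u v (X⊆Y Xu) (X⊆Y Xv))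

  colourable? : ∀ {X} → Decidable X → ∀ k → Dec (Colourable G X k)
  colourable? X? k = ∃-map? (N G) _
    (λ c≗c' proper u v Xu Xv uv e → proper u v Xu Xv uv (trans (c≗c' u) (trans e (sym (c≗c' v)))))
    (λ c → all? λ u → all? λ v → X? u →-dec (X? v →-dec (adj? u v →-dec ¬? (c u ≟ c v))))

  glue : ∀ {X A k} → Decidable A → (∀ {u v} → X u → X v → A u → Adj G u v → A v) →
    ColouringOf (X ∩ A) k → ColouringOf (X ∖ A) k → ColouringOf X k
  glue {X} {A} {k} A? closed (c₁ , proper₁) (c₂ , proper₂) = c , proper
    where
    pick : ∀ v → X v → Dec (A v) → Fin k
    pick v Xv (yes Av) = c₁ v (Xv , Av)
    pick v Xv (no ¬Av) = c₂ v (Xv , ¬Av)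
    c : ∀ v → X v → Fin k
    c v Xv = pick v Xv (A? v)
    distinct : ∀ {u v} Xu Xv (Au? : Dec (A u)) (Av? : Dec (A v)) → Adj G u v → pick u Xu Au? ≢ pick v Xv Av?
    distinct Xu Xv (yes Au) (yes Av) = proper₁ (Xu , Au) (Xv , Av)
    distinct Xu Xv (no ¬Au) (no ¬Av) = proper₂ (Xu , ¬Au) (Xv , ¬Av)
    distinct Xu Xv (yes Au) (no ¬Av) uv = ⊥-elim (¬Av (closed Xu Xv Au uv))
    distinct Xu Xv (no ¬Au) (yes Av) uv = ⊥-elim (¬Au (closed Xv Xu Av (adj-sym uv)))
    proper : ∀ {u v} (Xu : X u) (Xv : X v) → Adj G u v → c u Xu ≢ c v Xv
    proper Xu Xv = distinct Xu Xv (A? _) (A? _)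

  componentwise : ∀ {Y k} → Decidable Y → (∀ {x} → Y x → ColouringOf (Component G Y x) k) → ColouringOf Y k
  componentwise {Y} {k} = shrinking-induction Claim split Y
    where
    Claim : VSet G → Set
    Claim Y = Decidable Y → (∀ {x} → Y x → ColouringOf (Component G Y x) k) → ColouringOf Y k
    split : ∀ Y → (∀ {r} → Y r → ∀ Y' → Y' ⊆ Y → ¬ Y' r → Claim Y') → Claim Y
    split Y smaller Y? components with any? Y?
    ... | no empty = (λ v Yv → ⊥-elim (empty (v , Yv))) , λ Yu _ _ → ⊥-elim (empty (_ , Yu))
    ... | yes (r , Yr) =
      glue (reach? Y? r) (λ _ Yv Rru uv → step Rru Yv uv) (colouring-mono proj₂ (components Yr))
        (smaller Yr (Y ∖ Reach G Y r) proj₁ (λ (_ , ¬Rrr) → ¬Rrr (here Yr))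
           (Y? ∩? ∁? (reach? Y? r))
           (λ (Yx , _) → colouring-mono (reach-mono proj₁) (components Yx)))

  palette-union : ∀ {X A B a b} → Decidable A → (∀ {v} → X v → ¬ A v → B v) →
    ColouringOf A a → ColouringOf B b → ColouringOf X (a + b)
  palette-union {X} {A} {B} {a} {b} A? rest (c₁ , proper₁) (c₂ , proper₂) = c , proper
    where
    pick : ∀ v → X v → Dec (A v) → Fin a ⊎ Fin b
    pick v Xv (yes Av) = inj₁ (c₁ v Av)
    pick v Xv (no ¬Av) = inj₂ (c₂ v (rest Xv ¬Av))
    c : ∀ v → X v → Fin (a + b)
    c v Xv = join a b (pick v Xv (A? v))
    distinct : ∀ {u v} Xu Xv (Au? : Dec (A u)) (Av? : Dec (A v)) → Adj G u v → pick u Xu Au? ≢ pick v Xv Av?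
    distinct _ _ (yes Au) (yes Av) uv e = proper₁ Au Av uv (inj₁-injective e)
    distinct _ _ (no _) (no _) uv e = proper₂ _ _ uv (inj₂-injective e)
    distinct _ _ (yes _) (no _) uv ()
    distinct _ _ (no _) (yes _) uv ()
    proper : ∀ {u v} (Xu : X u) (Xv : X v) → Adj G u v → c u Xu ≢ c v Xv
    proper Xu Xv uv e = distinct Xu Xv (A? _) (A? _) uv (join-injective a b e)

  Ω? : (P : Seq G) → Decidable (InΩ G P)
  Ω? P v = all? (λ i → ¬? (vtx P i ≟ v)) ×-dec
           all? (λ i → ¬? (vtx P i ≟ lastV P) →-dec ¬? (adj? (vtx P i) v))

  -- Appending a neighbour u ∈ Ω(G,P) of the last vertex keeps a path
  -- induced: u is a new vertex and among P it sees only the last vertex.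
  extend-induced : (P : Seq G) → IsInducedPath G P → ∀ {u} → InΩ G P u → Adj G (lastV P) u →
    IsInducedPath G (P ▹ u)
  extend-induced (seq l f) (f-inj , f-adj) {u} (u∉P , u-far) wu = injective , adjacency
    where
    sees-last : ∀ i → Adj G (f i) u ⇔ i ≡ fromℕ l
    sees-last i = mk⇔ to from
      where
      to : Adj G (f i) u → i ≡ fromℕ l
      to fu with f i ≟ f (fromℕ l)
      ... | yes fi≡w = f-inj fi≡w
      ... | no fi≢w = ⊥-elim (u-far i fi≢w fu)
      from : i ≡ fromℕ l → Adj G (f i) u
      from refl = wu
    injective : ∀ {x y} → snoc f u x ≡ snoc f u y → x ≡ y
    injective {x} {y} e with view x | view y
    ... | ‵inject₁ i | ‵inject₁ j rewrite snoc-inject₁ f u i | snoc-inject₁ f u j = cong inject₁ (f-inj e)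
    ... | ‵inject₁ i | ‵fromℕ rewrite snoc-inject₁ f u i | snoc-last f u = ⊥-elim (u∉P i e)
    ... | ‵fromℕ | ‵inject₁ j rewrite snoc-inject₁ f u j | snoc-last f u = ⊥-elim (u∉P j (sym e))
    ... | ‵fromℕ | ‵fromℕ = refl
    adjacency : ∀ x y → Adj G (snoc f u x) (snoc f u y) ⇔ PathAdj x y
    adjacency x y with view x | view y
    ... | ‵inject₁ i | ‵inject₁ j rewrite snoc-inject₁ f u i | snoc-inject₁ f u j =
      ⇔-trans (f-adj i j) (⇔-sym (pathAdj-inject₁ i j))
    ... | ‵inject₁ i | ‵fromℕ rewrite snoc-inject₁ f u i | snoc-last f u =
      ⇔-trans (sees-last i) (⇔-sym (pathAdj-last i))
    ... | ‵fromℕ | ‵inject₁ j rewrite snoc-inject₁ f u j | snoc-last f u =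
      ⇔-trans (mk⇔ adj-sym adj-sym)
        (⇔-trans (sees-last j) (⇔-trans (⇔-sym (pathAdj-last j)) (mk⇔ pathAdj-sym pathAdj-sym)))
    ... | ‵fromℕ | ‵fromℕ = mk⇔ (⊥-elim ∘ adj-irrefl) (⊥-elim ∘ pathAdj-irrefl)

  -- Ω(G, P ▹ u) contains every vertex of Ω(G,P) that is not adjacent to the
  -- old last vertex w: such a vertex is neither u nor adjacent to P.
  Ω-▹ : (P : Seq G) → ∀ {u v} → Adj G (lastV P) u → InΩ G P v → ¬ Adj G (lastV P) v → InΩ G (P ▹ u) v
  Ω-▹ (seq l f) {u} {v} wu (v∉P , v-far) ¬wv = v∉P▹u , v-far▹u
    where
    v∉P▹u : ∀ j → snoc f u j ≢ v
    v∉P▹u j with view j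
    ... | ‵inject₁ i rewrite snoc-inject₁ f u i = v∉P i
    ... | ‵fromℕ rewrite snoc-last f u = λ { refl → ¬wv wu }
    v-far▹u : ∀ j → snoc f u j ≢ snoc f u (fromℕ (suc l)) → ¬ Adj G (snoc f u j) v
    v-far▹u j with view j
    ... | ‵fromℕ = λ j≢last → ⊥-elim (j≢last refl)
    ... | ‵inject₁ i rewrite snoc-inject₁ f u i with f i ≟ f (fromℕ l)
    ...   | yes fi≡w = λ _ fv → ¬wv (subst (λ z → Adj G z v) fi≡w fv)
    ...   | no fi≢w = λ _ → v-far i fi≢w

  C[_,_] : Seq G → Vertex G → VSet G
  C[ P , r ] = Component G (InΩ G P) r

  A[_,_] : Seq G → Vertex G → VSet G
  A[ P , r ] = C[ P , r ] ∩ Adj G (lastV P)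

  B[_,_] : Seq G → Vertex G → VSet G
  B[ P , r ] = C[ P , r ] ∖ Adj G (lastV P)

  C? : ∀ P r → Decidable C[ P , r ]
  C? P r = reach? (Ω? P) r

  A? : ∀ P r → Decidable A[ P , r ]
  A? P r = C? P r ∩? adj? (lastV P)

  B? : ∀ P r → Decidable B[ P , r ]
  B? P r = C? P r ∩? ∁? (adj? (lastV P))

  D-colourable? : ∀ P r x m → Dec (Colourable G (Component G B[ P , r ] x) m)
  D-colourable? P r x = colourable? (reach? (B? P r) x)

  B⊆Ω▹ : ∀ P r {u} → Adj G (lastV P) u → B[ P , r ] ⊆ InΩ G (P ▹ u)
  B⊆Ω▹ P r wu (Cv , ¬wv) = Ω-▹ P wu (reach-end Cv) ¬wv

  -- Each component D of B (here: that of x) is attached to P ▹ u for some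
  -- u ∈ A: a walk inside C from x to the neighbour of w that witnesses the
  -- attachment of C first enters N(w) at u, right after a vertex p of D.
  descend : ∀ P r {x} → Attached G P r → B[ P , r ] x →
    ∃ λ u → A[ P , r ] u × Attached G (P ▹ u) x
  descend P r (a , Cra , wa) (Crx , ¬wx)
    with first-entry (adj? (lastV P)) (reach-within Crx (reach-trans (reach-sym Crx) Cra)) ¬wx
  ... | inj₁ R = ⊥-elim (proj₂ (reach-end R) wa)
  ... | inj₂ (p , u , Rxp , pu , Au) =
    u , Au , p , reach-mono (B⊆Ω▹ P r (proj₂ Au)) Rxp , subst (λ z → Adj G z p) (sym (last-▹ P u)) (adj-sym pu)

  -- If A is d-colourable and every component of B is m-colourable, then C is
  -- (d + m)-colourable: colour A and B from disjoint palettes.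
  colour-C : ∀ P r {d m} → InΩ G P r → Colourable G A[ P , r ] d →
    (∀ {x} → B[ P , r ] x → Colourable G (Component G B[ P , r ] x) m) →
    Colourable G C[ P , r ] (d + m)
  colour-C P r Ωr colA colB = totalise (C? P r) (here Ωr)
    (palette-union (A? P r) (λ Cv ¬Av → Cv , λ wv → ¬Av (Cv , wv))
      (restrict colA) (componentwise (B? P r) (λ Bx → restrict (colB Bx))))

  extend-to-good : ∀ d k (P : Seq G) → IsInducedPath G P → ¬ HasInducedP G (suc (suc (len P + k))) →
    ∀ r → InΩ G P r → Attached G P r → ChiGt G C[ P , r ] (d * k) →
    ∃ λ P' → IsInducedPath G P' × Extends P' P × DGood G P' d
  extend-to-good d zero P induced P-free r Ωr (a , Cra , wa) _ =
    ⊥-elim (P-free (subst (λ m → HasInducedP G (suc (suc m))) (sym (+-identityʳ (len P)))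
      (vtx (P ▹ a) , extend-induced P induced (reach-end Cra) wa)))
  extend-to-good d (suc k) P induced P-free r Ωr attached χC with colourable? (A? P r) d
  ... | no χA = P , induced , extends-refl P , r , Ωr , χA
  ... | yes colA with any? (λ x → B? P r x ×-dec ¬? (D-colourable? P r x (d * k)))
  ...   | no no-bad-D = ⊥-elim (χC (subst (Colourable G C[ P , r ]) (sym (*-suc d k))
            (colour-C P r Ωr colA λ Bx → decidable-stable (D-colourable? P r _ (d * k)) λ χD → no-bad-D (_ , Bx , χD))))
  ...   | yes (x , Bx , χD) with descend P r attached Bx
  ...     | u , (Cu , wu) , attached' with
              extend-to-good d k (P ▹ u) (extend-induced P induced (reach-end Cu) wu)
                (subst (λ m → ¬ HasInducedP G (suc (suc m))) (+-suc (len P) k) P-free)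
                x (B⊆Ω▹ P r wu Bx) attached' (χ-mono (reach-mono (B⊆Ω▹ P r wu)) χD)
  ...       | P' , induced' , extends' , good = P' , induced' , extends-trans {Q = P ▹ u} extends' (extends-▹ P u) , good

two-vertex-path-induced : (G : Graph) (f : Fin 2 → Vertex G) → IsPath G (seq 1 f) → IsInducedPath G (seq 1 f)
two-vertex-path-induced G f (f-inj , f-adj) = f-inj , λ i j → mk⇔ (consecutive i j) (f-adj i j)
  where
  consecutive : ∀ i j → Adj G (f i) (f j) → PathAdj i j
  consecutive zero zero fi = ⊥-elim (adj-irrefl G fi)
  consecutive zero (suc zero) _ = inj₁ refl
  consecutive (suc zero) zero _ = inj₂ refl
  consecutive (suc zero) (suc zero) fi = ⊥-elim (adj-irrefl G fi)

-- Lemma 4.3: with len P = 1 and n = len P + k + 2, i.e. k = n - 3.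
lemma4p3 : (n d : ℕ) → 4 ≤ n → 1 ≤ d → (G : Graph) → ¬ HasInducedP G n →
    (P : Seq G) → len P ≡ 1 → IsPath G P →
    (r : Vertex G) → InΩ G P r → Attached G P r →
    ChiGt G (Component G (InΩ G P) r) (d * (n ∸ 3)) →
    ∃ λ (P' : Seq G) → IsInducedPath G P' × Extends P' P × DGood G P' d
lemma4p3 n d (s≤s (s≤s (s≤s _))) _ G Pn-free (seq .1 f) refl path =
  extend-to-good G d (n ∸ 3) (seq 1 f) (two-vertex-path-induced G f path) Pn-free
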